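{- Let $H$ be an ordered graph on $h$ vertices, let $r:=\chi_<(H)$, and let $\mathcal C$ be the set of interval $r$-colourings of $H$. Define $\ell_+(H):=\max_{(H_1<\dots<H_r)\in\mathcal C}\min_{i\in[r]}|H_i|$. Then $\chi^*_{cr}(H)\leq h/\ell_+(H)$.
   Context: An ordered graph on $h$ vertices is a graph with vertex set $[h]$ (ordered naturally); an ordered graph $G$ contains $H$ if there is an order-preserving injection $V(H)\to V(G)$ mapping edges to edges. For sets of integers, $X<Y$ means $a<b$ for all $a\in X,b\in Y$. An interval $r$-colouring of $H$ is a partition of $[h]$ into $r$ intervals $H_1<\dots<H_r$ with no edge inside any interval; $\chi_<(H)$ is the least such $r$. An $H$-tiling is a collection of vertex-disjoint copies of $H$; perfect if it covers all vertices. For a complete $k$-partite unordered graph $B$ with parts $U_1,\dots,U_k$ and a permutation $\sigma$ of $[k]$, an interval labelling w.r.t. $\sigma$ is a bijection $\phi:V(B)\to[|B|]$ with $\phi(U_i)<\phi(U_j)$ when $\sigma(i)<\sigma(j)$; the ordered blow-up $(B(t),\phi)$ replaces each vertex $x$ by $t$ independent vertices $V_x$ (complete bipartite between $V_x,V_y$ when $xy\in E(B)$) ordered so that $V_x<V_y$ when $\phi(x)<\phi(y)$. $B$ is a bottlegraph of $H$ if for every such $\sigma,\phi$ there is $t$ with $(B(t),\phi)$ containing a perfect $H$-tiling. $\chi_{cr}(F)=(\chi(F)-1)|F|/(|F|-\sigma(F))$ for unordered $F$, with $\sigma(F)$ the least size of a colour class over proper $\chi(F)$-colourings; $\chi^*_{cr}(H)=\inf\{\chi_{cr}(B):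 B \text{ a bottlegraph of } H\}$. -}

module Defs where

open import Data.Nat as ℕ using (ℕ; zero; suc; _∸_; _≤_; _<_)
open import Data.Fin as Fin using (Fin; toℕ; quotient)
open import Data.Bool using (Bool; true; false)
open import Data.Product using (Σ; ∃; _×_; _,_)
open import Data.Integer using (+_)
open import Data.Rational as ℚ using (ℚ; 0ℚ)
open import Function.Bundles using (_↔_; Inverse)
open import Relation.Binary.PropositionalEquality using (_≡_; _≢_)
open import Relation.Nullary using (¬_; Dec; yes; no)
open import Data.Fin using (_≟_)

-- Ordered graphs on [h] (vertex set Fin h with its natural order)

record OrderedGraph (h : ℕ) : Set₁ where
  field
    E      : Fin h → Fin h → Set
    E-sym  : ∀ {a b} → E a b → E b a
    E-irr  : ∀ {a} → ¬ E a a
open OrderedGraph public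

count : ∀ {n} {P : Fin n → Set} → (∀ x → Dec (P x)) → ℕ
count {zero}  d = 0
count {suc n} d with d Fin.zero
... | yes _ = suc (count {n} (λ x → d (Fin.suc x)))
... | no  _ = count {n} (λ x → d (Fin.suc x))

classSize : ∀ {n r} → (Fin n → Fin r) → Fin r → ℕ
classSize c i = count (λ x → c x ≟ i)

IsMinClassSize : ∀ {n r} → (Fin n → Fin r) → ℕ → Set
IsMinClassSize {r = r} c m =
  (∀ (i : Fin r) → m ≤ classSize c i) × (Σ (Fin r) λ i → classSize c i ≡ m)

-- Interval r-colourings: c a non-decreasing surjection Fin h → Fin r
-- (parts H_i = c⁻¹(i), nonempty intervals with H_1 < ... < H_r),
-- with no edge inside any interval.

record IntervalColouring {h} (H : OrderedGraph h) (r : ℕ) : Set where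
  field
    col      : Fin h → Fin r
    monotone : ∀ a b → toℕ a ≤ toℕ b → toℕ (col a) ≤ toℕ (col b)
    onto     : ∀ (i : Fin r) → Σ (Fin h) λ a → col a ≡ i
    indep    : ∀ a b → E H a b → col a ≢ col b
open IntervalColouring public

IsIntervalChromatic : ∀ {h} → OrderedGraph h → ℕ → Set
IsIntervalChromatic H r =
  IntervalColouring H r × (∀ r' → r' < r → ¬ IntervalColouring H r')

IsLPlus : ∀ {h} → OrderedGraph h → ℕ → ℕ → Set
IsLPlus H r ℓ =
  (Σ (IntervalColouring H r) λ C → IsMinClassSize (col C) ℓ) ×
  (∀ (C : IntervalColouring H r) (m : ℕ) → IsMinClassSize (col C) m → m ≤ ℓ)

StrictMono : ∀ {h M} → (Fin h → Fin M) → Set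
StrictMono {h} e = ∀ (a b : Fin h) → toℕ a < toℕ b → toℕ (e a) < toℕ (e b)

IsCopy : ∀ {h M} → OrderedGraph h → (Fin M → Fin M → Set) → (Fin h → Fin M) → Set
IsCopy H G e = StrictMono e × (∀ a b → E H a b → G (e a) (e b))

record PerfectTiling {h M} (H : OrderedGraph h) (G : Fin M → Fin M → Set) : Set where
  field
    m        : ℕ
    copy     : Fin m → Fin h → Fin M
    isCopy   : ∀ i → IsCopy H G (copy i)
    disjoint : ∀ i j a b → copy i a ≡ copy j b → i ≡ j
    covers   : ∀ (v : Fin M) → Σ (Fin m) λ i → Σ (Fin h) λ a → copy i a ≡ v

-- Complete k-partite (unordered) graphs on Fin N: part : Fin N → Fin k,
-- parts U_i = part⁻¹(i), all nonempty; xy an edge iff part x ≢ part y.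

record CompleteMultipartite : Set where
  field
    N    : ℕ
    k    : ℕ
    part : Fin N → Fin k
    onto : ∀ (i : Fin k) → Σ (Fin N) λ x → part x ≡ i
open CompleteMultipartite public

edgesOf : (B : CompleteMultipartite) → Fin (N B) → Fin (N B) → Set
edgesOf B x y = part B x ≢ part B y

IsIntervalLabelling : (B : CompleteMultipartite) → (Fin (k B) ↔ Fin (k B)) →
                      (Fin (N B) ↔ Fin (N B)) → Set
IsIntervalLabelling B σ φ =
  ∀ x y → toℕ (Inverse.to σ (part B x)) < toℕ (Inverse.to σ (part B y)) →
          toℕ (Inverse.to φ x) < toℕ (Inverse.to φ y)

-- The ordered blow-up (B(t), φ) on Fin (N * t): position p lies in the
-- block V_x with φ(x) = quotient t p; blocks are ordered by φ.
blowUp : (B : CompleteMultipartite) → (Fin (N B) ↔ Fin (N B)) → (t : ℕ) →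
         Fin (N B ℕ.* t) → Fin (N B ℕ.* t) → Set
blowUp B φ t p q =
  edgesOf B (Inverse.from φ (quotient t p)) (Inverse.from φ (quotient t q))

IsBottlegraph : ∀ {h} → OrderedGraph h → CompleteMultipartite → Set
IsBottlegraph H B =
  ∀ (σ : Fin (k B) ↔ Fin (k B)) (φ : Fin (N B) ↔ Fin (N B)) →
  IsIntervalLabelling B σ φ →
  Σ ℕ λ t → (1 ≤ t) × PerfectTiling H (blowUp B φ t)

ProperColouring : ∀ {n} → (Fin n → Fin n → Set) → (c : ℕ) → (Fin n → Fin c) → Set
ProperColouring F c col = ∀ x y → F x y → col x ≢ col y

IsChromatic : ∀ {n} → (Fin n → Fin n → Set) → ℕ → Set
IsChromatic {n} F c =
  (Σ (Fin n → Fin c) (ProperColouring F c)) ×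
  (∀ c' → c' < c → ¬ Σ (Fin n → Fin c') (ProperColouring F c'))

IsSigma : ∀ {n} → (Fin n → Fin n → Set) → ℕ → ℕ → Set
IsSigma {n} F c s =
  (Σ (Fin n → Fin c) λ col → ProperColouring F c col × Σ (Fin c) λ i → classSize col i ≡ s) ×
  (∀ (col : Fin n → Fin c) → ProperColouring F c col → ∀ i → s ≤ classSize col i)

-- a / d as a rational (only used with d ≥ 1)
_÷ℕ_ : ℕ → ℕ → ℚ
a ÷ℕ zero    = 0ℚ
a ÷ℕ (suc d) = (+ a) ℚ./ suc d

-- χ_cr(F) = q, defined when |F| > σ(F)
IsChiCr : ∀ {n} → (Fin n → Fin n → Set) → ℚ → Set
IsChiCr {n} F q = Σ ℕ λ c → Σ ℕ λ s →
  IsChromatic F c × IsSigma F c s × (s < n) ×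
  (q ≡ (((c ∸ 1) ℕ.* n) ÷ℕ (n ∸ s)))

-- χ*_cr(H) ≤ x  (infimum over bottlegraphs B of χ_cr(B) is at most x)
ChiStarCrLe : ∀ {h} → OrderedGraph h → ℚ → Set
ChiStarCrLe H x =
  ∀ (ε : ℚ) → 0ℚ ℚ.< ε →
  Σ CompleteMultipartite λ B → IsBottlegraph H B ×
  Σ ℚ λ q → IsChiCr (edgesOf B) q × (q ℚ.≤ x ℚ.+ ε)

module Submission where

-- Only the interval colouring H₁ < … < H_r witnessing ℓ₊(H) is used, not its maximality.
-- If r = 1 then H has no edges, every blow-up is tiled by H, and bottlegraphs with χ_cr
-- arbitrarily close to 1 = h/ℓ exist.  Otherwise ℓ < h: write h = qℓ + ρ + 1 with ρ < ℓ and let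
-- B be the complete (q+1)-partite graph on [h] whose parts are the consecutive blocks of ℓ
-- vertices (the last one of ρ + 1), so χ_cr(B) = qh/(qℓ) = h/ℓ.  Under an interval labelling each
-- part of B is an interval of at most ℓ labels.  In B(t), t = h!, the j-th copy of H sends the
-- class H_i, of size a and starting at s, into the blocks s + ⌊ja/t⌋; as every class has at least
-- ℓ vertices, vertices of different classes land in blocks at least ℓ apart, hence in different
-- parts of B, so every edge of H is present.

open import Defs

open import Data.Empty using (⊥; ⊥-elim)
open import Data.Fin as Fin using (Fin; toℕ; fromℕ<; fromℕ)
open import Data.Fin.Properties as FinP
  using (toℕ-injective; toℕ-fromℕ<; toℕ<n; pigeonhole; punchOut-injective; any?)
import Data.Integer as ℤ
import Data.Integer.Properties as ℤP
open import Data.Nat as ℕ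
  using (ℕ; zero; suc; _+_; _*_; _∸_; _≤_; _<_; z≤n; s≤s; s≤s⁻¹; _<?_; _≤?_; NonZero; ≢-nonZero; _/_; _%_; _!)
open import Data.Nat.Divisibility using (_∣_; n∣m*n; m∣m*n; ∣-trans; m≤n⇒m!∣n!)
open import Data.Nat.DivMod
open import Data.Nat.Properties
open import Data.Nat.Solver using (module +-*-Solver)
open import Data.Nat.Tactic.RingSolver using (solve-∀)
open import Data.Product using (Σ; ∃-syntax; _×_; _,_; proj₁; proj₂)
open import Data.Rational as ℚ using (mkℚ; 0ℚ)
import Data.Rational.Properties as ℚP
open import Data.Rational.Unnormalised as ℚᵘ using (mkℚᵘ)
import Data.Rational.Unnormalised.Properties as ℚᵘP
open import Data.Sum using (_⊎_; inj₁; inj₂; [_,_]; map₂)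
open import Function using (_∘_; id; it)
open import Function.Bundles using (_↔_; Inverse)
open import Function.Definitions using (Injective)
open import Level using (0ℓ)
open import Relation.Binary.Definitions using (tri<; tri≈; tri>)
open import Relation.Binary.PropositionalEquality hiding ([_])
open import Relation.Nullary using (¬_; yes; no; _⊎-dec_; _×-dec_)
import Relation.Nullary.Decidable as Dec
open import Relation.Unary using (Pred; Decidable; _⊆_; _∪_; _≐_)

-- Counting

count-≤ : ∀ {n} {P : Pred (Fin n) 0ℓ} (P? : Decidable P) → count P? ≤ n
count-≤ {zero}  P? = z≤n
count-≤ {suc n} P? with P? Fin.zero
... | yes _ = s≤s (count-≤ (P? ∘ Fin.suc))
... | no  _ = m≤n⇒m≤1+n (count-≤ (P? ∘ Fin.suc))

count-pos : ∀ {n} {P : Pred (Fin n) 0ℓ} (P? : Decidable P) → ∀ x → P x → 1 ≤ count P?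
count-pos {suc n} P? x px with P? Fin.zero | x
... | yes _  | _        = s≤s z≤n
... | no ¬p₀ | Fin.zero = ⊥-elim (¬p₀ px)
... | no _   | Fin.suc x = count-pos (P? ∘ Fin.suc) x px

count-mono : ∀ {n} {P Q : Pred (Fin n) 0ℓ} (P? : Decidable P) (Q? : Decidable Q) → P ⊆ Q → count P? ≤ count Q?
count-mono {zero}  P? Q? P⊆Q = z≤n
count-mono {suc n} P? Q? P⊆Q with P? Fin.zero | Q? Fin.zero
... | yes _ | yes _ = s≤s (count-mono (P? ∘ Fin.suc) (Q? ∘ Fin.suc) P⊆Q)
... | yes p | no ¬q = ⊥-elim (¬q (P⊆Q p))
... | no _  | yes _ = m≤n⇒m≤1+n (count-mono (P? ∘ Fin.suc) (Q? ∘ Fin.suc) P⊆Q)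
... | no _  | no _  = count-mono (P? ∘ Fin.suc) (Q? ∘ Fin.suc) P⊆Q

count-empty : ∀ {n} {P : Pred (Fin n) 0ℓ} (P? : Decidable P) → (∀ x → ¬ P x) → count P? ≡ 0
count-empty {zero}  P? ∅ = refl
count-empty {suc n} P? ∅ with P? Fin.zero
... | yes p = ⊥-elim (∅ _ p)
... | no _  = count-empty (P? ∘ Fin.suc) (∅ ∘ Fin.suc)

count-split : ∀ {n} {P Q R : Pred (Fin n) 0ℓ} (R? : Decidable R) (P? : Decidable P) (Q? : Decidable Q) →
              R ⊆ P ∪ Q → P ⊆ R → Q ⊆ R → (∀ {x} → P x → ¬ Q x) →
              count R? ≡ count P? + count Q?
count-split {zero}  R? P? Q? R⊆P∪Q P⊆R Q⊆R disj = refl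
count-split {suc n} R? P? Q? R⊆P∪Q P⊆R Q⊆R disj
  with R? Fin.zero | P? Fin.zero | Q? Fin.zero
     | count-split (R? ∘ Fin.suc) (P? ∘ Fin.suc) (Q? ∘ Fin.suc) R⊆P∪Q P⊆R Q⊆R disj
... | _     | yes p | yes q | _    = ⊥-elim (disj p q)
... | yes _ | yes _ | no _  | rest = cong suc rest
... | yes _ | no _  | yes _ | rest = trans (cong suc rest) (sym (+-suc _ _))
... | yes r | no ¬p | no ¬q | _    = ⊥-elim ([ ¬p , ¬q ] (R⊆P∪Q r))
... | no ¬r | yes p | no _  | _    = ⊥-elim (¬r (P⊆R p))
... | no ¬r | no _  | yes q | _    = ⊥-elim (¬r (Q⊆R q))
... | no _  | no _  | no _  | rest = rest

count-prefix : ∀ {n} {P : Pred (Fin n) 0ℓ} (P? : Decidable P) {m} → m ≤ n →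
               P ≐ (λ x → toℕ x < m) → count P? ≡ m
count-prefix P? {zero} _ (P⊆ , _) = count-empty P? (λ x p → n≮0 (P⊆ p))
count-prefix {suc n} P? {suc m} (s≤s m≤n) (P⊆ , ⊆P) with P? Fin.zero
... | yes _ = cong suc (count-prefix (P? ∘ Fin.suc) m≤n (s≤s⁻¹ ∘ P⊆ , ⊆P ∘ s≤s))
... | no ¬p = ⊥-elim (¬p (⊆P (s≤s z≤n)))

count-interval : ∀ {n} {P : Pred (Fin n) 0ℓ} (P? : Decidable P) {lo hi} → lo ≤ hi → hi ≤ n →
                 P ≐ (λ x → lo ≤ toℕ x × toℕ x < hi) → count P? ≡ hi ∸ lo
count-interval {n} P? {lo} {hi} lo≤hi hi≤n (P⊆ , ⊆P) = begin
  count P?                           ≡⟨ m+n∸m≡n lo (count P?) ⟨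
  lo + count P? ∸ lo                 ≡⟨ cong (λ m → m + count P? ∸ lo) count-below-lo ⟨
  count (below lo) + count P? ∸ lo   ≡⟨ cong (_∸ lo) split-below-hi ⟨
  count (below hi) ∸ lo              ≡⟨ cong (_∸ lo) (count-prefix (below hi) hi≤n (id , id)) ⟩
  hi ∸ lo                            ∎
  where
  open ≡-Reasoning
  below : ∀ m → Decidable (λ (x : Fin n) → toℕ x < m)
  below m x = toℕ x <? m
  count-below-lo : count (below lo) ≡ lo
  count-below-lo = count-prefix (below lo) (≤-trans lo≤hi hi≤n) (id , id)
  split-below-hi : count (below hi) ≡ count (below lo) + count P?
  split-below-hi = count-split (below hi) (below lo) P?
    (λ {x} x<hi → map₂ (λ x≮lo → ⊆P (≮⇒≥ x≮lo , x<hi)) (Dec.toSum (below lo x)))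
    (λ x<lo → <-≤-trans x<lo lo≤hi) (proj₂ ∘ P⊆) (λ x<lo p → <⇒≱ x<lo (proj₁ (P⊆ p)))

count-initial : ∀ {n} {P : Pred (Fin n) 0ℓ} (P? : Decidable P) →
                (∀ {x y} → toℕ y ≤ toℕ x → P x → P y) → P ≐ (λ x → toℕ x < count P?)
count-initial {zero}      P? down = (λ { {()} }) , (λ { {()} })
count-initial {suc n} {P} P? down with P? Fin.zero
... | yes p₀ = P⊆ , ⊆P
  where
  ih = count-initial (P? ∘ Fin.suc) (down ∘ s≤s)
  P⊆ : P ⊆ (λ x → toℕ x < suc (count (P? ∘ Fin.suc)))
  P⊆ {Fin.zero}  _ = s≤s z≤n
  P⊆ {Fin.suc x} p = s≤s (proj₁ ih p)
  ⊆P : (λ x → toℕ x < suc (count (P? ∘ Fin.suc))) ⊆ P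
  ⊆P {Fin.zero}  _         = p₀
  ⊆P {Fin.suc x} (s≤s x<c) = proj₂ ih x<c
... | no ¬p₀ = (λ p → ⊥-elim (none p)) , (λ x<c → ⊥-elim (n≮0 (subst (_ <_) empty x<c)))
  where
  none : ∀ {x} → ¬ P x
  none p = ¬p₀ (down z≤n p)
  empty : count (P? ∘ Fin.suc) ≡ 0
  empty = count-empty (P? ∘ Fin.suc) (λ _ → none)

classSize-+-≤ : ∀ {n r} (c : Fin n → Fin r) {i j} → i ≢ j → classSize c i + classSize c j ≤ n
classSize-+-≤ c {i} {j} i≢j = subst (_≤ _) partition (count-≤ either?)
  where
  either? : Decidable (λ x → c x ≡ i ⊎ c x ≡ j)
  either? x = (c x Fin.≟ i) ⊎-dec (c x Fin.≟ j)
  partition : count either? ≡ classSize c i + classSize c j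
  partition = count-split either? _ _ (λ p → p) inj₁ inj₂ (λ ci cj → i≢j (trans (sym ci) cj))

-- Interval colourings

module IntervalClasses {h r} {H : OrderedGraph h} (C : IntervalColouring H r) where

  size : Fin r → ℕ
  size = classSize (col C)

  colour<? : ∀ i → Decidable (λ u → toℕ (col C u) < i)
  colour<? i u = toℕ (col C u) <? i

  boundary : ℕ → ℕ
  boundary i = count (colour<? i)

  colour<⇔<boundary : ∀ i → (λ u → toℕ (col C u) < i) ≐ (λ u → toℕ u < boundary i)
  colour<⇔<boundary i = count-initial _ (λ y≤x cx<i → ≤-<-trans (monotone C _ _ y≤x) cx<i)

  boundary-suc : ∀ i → boundary (suc (toℕ i)) ≡ boundary (toℕ i) + size i
  boundary-suc i = count-split (colour<? _) (colour<? _) (λ u → col C u Fin.≟ i)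
                    below-or-at m≤n⇒m≤1+n (s≤s ∘ ≤-reflexive ∘ cong toℕ) (λ c<i c≡i → <-irrefl (cong toℕ c≡i) c<i)
    where
    below-or-at : ∀ {u} → toℕ (col C u) < suc (toℕ i) → toℕ (col C u) < toℕ i ⊎ col C u ≡ i
    below-or-at (s≤s c≤i) = map₂ toℕ-injective (m≤n⇒m<n∨m≡n c≤i)

  boundary-mono : ∀ {i j} → i ≤ j → boundary i ≤ boundary j
  boundary-mono i≤j = count-mono (colour<? _) (colour<? _) (λ c<i → <-≤-trans c<i i≤j)

  classStart classEnd classSizeOf : Fin h → ℕ
  classStart v = boundary (toℕ (col C v))
  classSizeOf v     = size (col C v)
  classEnd v   = classStart v + classSizeOf v

  classStart≤ : ∀ v → classStart v ≤ toℕ v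
  classStart≤ v = ≮⇒≥ (λ v<boundary → <-irrefl refl (proj₂ (colour<⇔<boundary _) v<boundary))

  <classEnd : ∀ v → toℕ v < classEnd v
  <classEnd v = subst (toℕ v <_) (boundary-suc (col C v)) (proj₁ (colour<⇔<boundary _) ≤-refl)

  classEnd≤ : ∀ v → classEnd v ≤ h
  classEnd≤ v = subst (_≤ h) (boundary-suc (col C v)) (count-≤ _)

  sameClass : ∀ v w → classStart v ≤ toℕ w → toℕ w < classEnd v → col C w ≡ col C v
  sameClass v w start≤w w<end = toℕ-injective (≤-antisym cw≤cv cv≤cw)
    where
    cw≤cv : toℕ (col C w) ≤ toℕ (col C v)
    cw≤cv = s≤s⁻¹ (proj₂ (colour<⇔<boundary _) (subst (toℕ w <_) (sym (boundary-suc (col C v))) w<end))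
    cv≤cw : toℕ (col C v) ≤ toℕ (col C w)
    cv≤cw = ≮⇒≥ (λ cw<cv → <⇒≱ (proj₁ (colour<⇔<boundary _) cw<cv) start≤w)

  classStart-after : ∀ v w → toℕ (col C v) < toℕ (col C w) →
                     classStart w ≡ classEnd v ⊎ Σ (Fin r) λ i → classEnd v + size i ≤ classStart w
  classStart-after v w cv<cw with m≤n⇒m<n∨m≡n cv<cw
  ... | inj₂ cv+1≡cw = inj₁ (trans (cong boundary (sym cv+1≡cw)) (boundary-suc (col C v)))
  ... | inj₁ cv+1<cw = inj₂ (next , (begin
    classEnd v + size next                      ≡⟨ cong (_+ size next) (boundary-suc (col C v)) ⟨
    boundary (suc (toℕ (col C v))) + size next  ≡⟨ cong (λ i → boundary i + size next) toℕ-next ⟨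
    boundary (toℕ next) + size next             ≡⟨ boundary-suc next ⟨
    boundary (suc (toℕ next))                   ≤⟨ boundary-mono (subst (λ i → suc i ≤ _) (sym toℕ-next) cv+1<cw) ⟩
    classStart w                                ∎))
    where
    open ≤-Reasoning
    next<r : suc (toℕ (col C v)) < r
    next<r = ≤-<-trans cv<cw (toℕ<n (col C w))
    next : Fin r
    next = Fin.fromℕ< next<r
    toℕ-next : toℕ next ≡ suc (toℕ (col C v))
    toℕ-next = toℕ-fromℕ< next<r


<[1+m/n]*n : ∀ m n .{{_ : NonZero n}} → m < suc (m / n) * n
<[1+m/n]*n m n = begin-strict
  m                   ≡⟨ m≡m%n+[m/n]*n m n ⟩
  m % n + m / n * n   <⟨ +-monoˡ-< (m / n * n) (m%n<n m n) ⟩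
  n + m / n * n       ≡⟨⟩
  suc (m / n) * n     ∎
  where open ≤-Reasoning

m*n+o<m*p : ∀ {m n o p} → o < m → n < p → m * n + o < m * p
m*n+o<m*p {m} {n} {o} {p} o<m n<p = begin-strict
  m * n + o     <⟨ +-monoʳ-< (m * n) o<m ⟩
  m * n + m     ≡⟨ trans (+-comm (m * n) m) (sym (*-suc m n)) ⟩
  m * suc n     ≤⟨ *-monoʳ-≤ m n<p ⟩
  m * p         ∎
  where open ≤-Reasoning

[m*n+o]/n≡m : ∀ m {n o} .{{_ : NonZero n}} → o < n → (m * n + o) / n ≡ m
[m*n+o]/n≡m m {n} {o} o<n = begin
  (m * n + o) / n      ≡⟨ +-distrib-/-∣ˡ o (n∣m*n m) ⟩
  m * n / n + o / n    ≡⟨ cong₂ _+_ (m*n/n≡m m n) (m<n⇒m/n≡0 o<n) ⟩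
  m + 0                ≡⟨ +-identityʳ m ⟩
  m                    ∎
  where open ≡-Reasoning

*+-cancel : ∀ {a i j k k'} → k < a → k' < a → a * i + k ≡ a * j + k' → i ≡ j
*+-cancel {a} {i} {j} {k} {k'} k<a k'<a same = begin
  i                  ≡⟨ [m*n+o]/n≡m i k<a ⟨
  (i * a + k) / a    ≡⟨ cong (λ x → (x + k) / a) (*-comm i a) ⟩
  (a * i + k) / a    ≡⟨ cong (_/ a) same ⟩
  (a * j + k') / a   ≡⟨ cong (λ x → (x + k') / a) (*-comm a j) ⟩
  (j * a + k') / a   ≡⟨ [m*n+o]/n≡m j k'<a ⟩
  j                  ∎
  where
  open ≡-Reasoning
  instance
    a≢0 : NonZero a
    a≢0 = ℕ.>-nonZero (m<n⇒0<n k<a)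

-- With t = a u = a' u' and x = j/t, this says ⌊x a⌋ + l ≤ a + ⌊x a'⌋: it holds because
-- l ≤ (1 - x) a + x a' for l ≤ min(a, a').
floor-shift-≤ : ∀ {a a' u u' l j} .{{_ : NonZero u}} .{{_ : NonZero u'}} →
                a * u ≡ a' * u' → j < a * u → l ≤ a → l ≤ a' → j / u + l ≤ a + j / u'
floor-shift-≤ {a} {a'} {u} {u'} {l} {j} au≡a'u' j<t l≤a l≤a' =
  s≤s⁻¹ (subst (suc (D + l) ≤_) (+-suc a F) (*-cancelʳ-< t (D + l) (a + suc F) scaled))
  where
  open ≤-Reasoning
  open +-*-Solver
  t = a * u
  D = j / u
  F = j / u'
  instance
    a'≢0 : NonZero a'
    a'≢0 = m*n≢0⇒m≢0 a' {n = u'} {{≢-nonZero (λ a'u'≡0 → n≮0 (subst (j <_) (trans au≡a'u' a'u'≡0) j<t))}}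
  Dt≤ja : D * t ≤ j * a
  Dt≤ja = begin
    D * (a * u)   ≡⟨ solve 3 (λ D a u → D :* (a :* u) := D :* u :* a) refl D a u ⟩
    D * u * a     ≤⟨ *-monoˡ-≤ a (m/n*n≤m j u) ⟩
    j * a         ∎
  lt≤ : l * t ≤ a * (t ∸ j) + a' * j
  lt≤ = begin
    l * t                     ≡⟨ cong (l *_) (m∸n+n≡m (<⇒≤ j<t)) ⟨
    l * (t ∸ j + j)           ≡⟨ *-distribˡ-+ l (t ∸ j) j ⟩
    l * (t ∸ j) + l * j       ≤⟨ +-mono-≤ (*-monoˡ-≤ (t ∸ j) l≤a) (*-monoˡ-≤ j l≤a') ⟩
    a * (t ∸ j) + a' * j      ∎
  ja+a[t∸j]≡at : j * a + a * (t ∸ j) ≡ a * t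
  ja+a[t∸j]≡at = trans (cong (_+ a * (t ∸ j)) (*-comm j a))
                   (trans (sym (*-distribˡ-+ a j (t ∸ j))) (cong (a *_) (m+[n∸m]≡n (<⇒≤ j<t))))
  scaled : (D + l) * t < (a + suc F) * t
  scaled = begin-strict
    (D + l) * t                         ≡⟨ *-distribʳ-+ t D l ⟩
    D * t + l * t                       ≤⟨ +-mono-≤ Dt≤ja lt≤ ⟩
    j * a + (a * (t ∸ j) + a' * j)      ≡⟨ +-assoc (j * a) _ _ ⟨
    j * a + a * (t ∸ j) + a' * j        ≡⟨ cong (_+ a' * j) ja+a[t∸j]≡at ⟩
    a * t + a' * j                      <⟨ +-monoʳ-< (a * t) (*-monoʳ-< a' (<[1+m/n]*n j u')) ⟩
    a * t + a' * (suc F * u')           ≡⟨ cong (a * t +_) (solve 3 (λ a' F u' → a' :* (F :* u') := F :* (a' :* u'))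
                                                                     refl a' (suc F) u') ⟩
    a * t + suc F * (a' * u')           ≡⟨ cong (λ t' → a * t + suc F * t') au≡a'u' ⟨
    a * t + suc F * t                   ≡⟨ *-distribʳ-+ t a (suc F) ⟨
    (a + suc F) * t                     ∎

-- Complete multipartite graphs and interval labellings

Fin-injective⇒surjective : ∀ {n} (f : Fin n → Fin n) → Injective _≡_ _≡_ f → ∀ y → ∃[ x ] f x ≡ y
Fin-injective⇒surjective {suc n} f f-inj y with any? (λ x → f x Fin.≟ y)
... | yes hit = hit
... | no miss = ⊥-elim (collision (pigeonhole (n<1+n n) (λ x → Fin.punchOut (y≢f x))))
  where
  y≢f : ∀ x → y ≢ f x
  y≢f x y≡fx = miss (x , sym y≡fx)
  collision : ∃[ i ] ∃[ j ] i Fin.< j × Fin.punchOut (y≢f i) ≡ Fin.punchOut (y≢f j) → ⊥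
  collision (i , j , i<j , same) = FinP.<⇒≢ i<j (f-inj (punchOut-injective (y≢f i) (y≢f j) same))

module _ (B : CompleteMultipartite) where

  representative : Fin (k B) → Fin (N B)
  representative i = proj₁ (onto B i)

  representatives-adjacent : ∀ {i j} → i ≢ j → edgesOf B (representative i) (representative j)
  representatives-adjacent {i} {j} i≢j same = i≢j (trans (sym (proj₂ (onto B i))) (trans same (proj₂ (onto B j))))

  multipartite-chromatic : IsChromatic (edgesOf B) (k B)
  multipartite-chromatic = (part B , λ _ _ different → different) , fewer-colours-improper
    where
    fewer-colours-improper : ∀ c' → c' < k B → ¬ Σ (Fin (N B) → Fin c') (ProperColouring (edgesOf B) c')
    fewer-colours-improper c' c'<k (c , proper) with pigeonhole c'<k (c ∘ representative)
    ... | i , j , i<j , same = proper _ _ (representatives-adjacent (FinP.<⇒≢ i<j)) same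

  module _ {c : Fin (N B) → Fin (k B)} (proper : ProperColouring (edgesOf B) (k B) c) where

    colour-onto-representatives : ∀ i → ∃[ p ] c (representative p) ≡ i
    colour-onto-representatives = Fin-injective⇒surjective (c ∘ representative) injective
      where
      injective : Injective _≡_ _≡_ (c ∘ representative)
      injective {i} {j} same with i Fin.≟ j
      ... | yes i≡j = i≡j
      ... | no  i≢j = ⊥-elim (proper _ _ (representatives-adjacent i≢j) same)

    colourClass-⊇-part : ∀ i → ∃[ p ] ∀ x → part B x ≡ p → c x ≡ i
    colourClass-⊇-part i = p , monochromatic
      where
      p = proj₁ (colour-onto-representatives i)
      monochromatic : ∀ x → part B x ≡ p → c x ≡ i
      monochromatic x x∈p with colour-onto-representatives (c x)
      ... | p' , cp'≡cx with p' Fin.≟ p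
      ... | yes refl = trans (sym cp'≡cx) (proj₂ (colour-onto-representatives i))
      ... | no  p'≢p = ⊥-elim (proper x (representative p') x~p' (sym cp'≡cx))
        where
        x~p' : edgesOf B x (representative p')
        x~p' same = p'≢p (trans (sym (proj₂ (onto B p'))) (trans (sym same) x∈p))

module _ (B : CompleteMultipartite) (φ : Fin (N B) ↔ Fin (N B)) where

  partAt : Fin (N B) → Fin (k B)
  partAt b = part B (Inverse.from φ b)

  PartsFitInWindow : ℕ → Set
  PartsFitInWindow L = ∀ {b b'} → toℕ b ≤ toℕ b' → partAt b ≡ partAt b' → toℕ b' < toℕ b + L

module _ (B : CompleteMultipartite) {σ : Fin (k B) ↔ Fin (k B)} {φ : Fin (N B) ↔ Fin (N B)}
         (labelling : IsIntervalLabelling B σ φ) where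

  open Inverse

  private
    earlier : ∀ b b' → toℕ (to σ (partAt B φ b)) < toℕ (to σ (partAt B φ b')) → toℕ b < toℕ b'
    earlier b b' σb<σb' = subst₂ (λ x y → toℕ x < toℕ y) (strictlyInverseˡ φ b) (strictlyInverseˡ φ b')
                                 (labelling _ _ σb<σb')

    from-injective : ∀ {b b'} → from φ b ≡ from φ b' → b ≡ b'
    from-injective {b} {b'} same =
      trans (sym (strictlyInverseˡ φ b)) (trans (cong (to φ) same) (strictlyInverseˡ φ b'))

  partAt-convex : ∀ {b m b'} → toℕ b ≤ toℕ m → toℕ m ≤ toℕ b' →
                  partAt B φ b ≡ partAt B φ b' → partAt B φ m ≡ partAt B φ b
  partAt-convex {b} {m} {b'} b≤m m≤b' same with FinP.<-cmp (to σ (partAt B φ m)) (to σ (partAt B φ b))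
  ... | tri< σm<σb _ _ = ⊥-elim (<⇒≱ (earlier m b σm<σb) b≤m)
  ... | tri≈ _ σm≡σb _ = trans (sym (strictlyInverseʳ σ _)) (trans (cong (from σ) σm≡σb) (strictlyInverseʳ σ _))
  ... | tri> _ _ σb<σm = ⊥-elim (<⇒≱ (earlier b' m σb'<σm) m≤b')
    where
    σb'<σm : toℕ (to σ (partAt B φ b')) < toℕ (to σ (partAt B φ m))
    σb'<σm = subst (λ p → toℕ (to σ p) < toℕ (to σ (partAt B φ m))) same σb<σm

  -- Otherwise L + 1 consecutive labels lie in one part by convexity, and two collide under ι.
  partsFitInWindow : ∀ {L} (ι : Fin (N B) → Fin L) → (∀ {x y} → part B x ≡ part B y → ι x ≡ ι y → x ≡ y) →
                     PartsFitInWindow B φ L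
  partsFitInWindow {L} ι ι-injective {b} {b'} b≤b' same with toℕ b' <? toℕ b + L
  ... | yes b'<b+L = b'<b+L
  ... | no  b'≮b+L = ⊥-elim (collision (pigeonhole (n<1+n L) (ι ∘ from φ ∘ label)))
    where
    b+d≤b' : (d : Fin (suc L)) → toℕ b + toℕ d ≤ toℕ b'
    b+d≤b' d = ≤-trans (+-monoʳ-≤ (toℕ b) (s≤s⁻¹ (toℕ<n d))) (≮⇒≥ b'≮b+L)
    label : Fin (suc L) → Fin (N B)
    label d = fromℕ< (≤-<-trans (b+d≤b' d) (toℕ<n b'))
    toℕ-label : ∀ d → toℕ (label d) ≡ toℕ b + toℕ d
    toℕ-label d = toℕ-fromℕ< _
    label-part : ∀ d → partAt B φ (label d) ≡ partAt B φ b
    label-part d = partAt-convex (subst (toℕ b ≤_) (sym (toℕ-label d)) (m≤m+n _ _))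
                                 (subst (_≤ toℕ b') (sym (toℕ-label d)) (b+d≤b' d)) same
    label-injective : ∀ {d d'} → label d ≡ label d' → d ≡ d'
    label-injective {d} {d'} same-label =
      toℕ-injective (+-cancelˡ-≡ (toℕ b) _ _
        (trans (sym (toℕ-label d)) (trans (cong toℕ same-label) (toℕ-label d'))))
    collision : ∃[ d ] ∃[ d' ] d Fin.< d' × ι (from φ (label d)) ≡ ι (from φ (label d')) → ⊥
    collision (d , d' , d<d' , same-ι) =
      FinP.<⇒≢ d<d' (label-injective (from-injective
        (ι-injective (trans (label-part d) (sym (label-part d'))) same-ι)))

-- The block graph

module BlockGraph (L q ρ : ℕ) .{{_ : NonZero L}} (ρ<L : ρ < L) where

  order : ℕ
  order = q * L + suc ρ

  order≤ : order ≤ suc q * L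
  order≤ = begin
    q * L + suc ρ  ≤⟨ +-monoʳ-≤ (q * L) ρ<L ⟩
    q * L + L      ≡⟨ +-comm (q * L) L ⟩
    suc q * L      ∎
    where open ≤-Reasoning

  block : Fin order → Fin (suc q)
  block x = fromℕ< (m<n*o⇒m/o<n (<-≤-trans (toℕ<n x) order≤))

  toℕ-block : ∀ x → toℕ (block x) ≡ toℕ x / L
  toℕ-block x = toℕ-fromℕ< _

  block≐interval : ∀ p → (λ x → block x ≡ p) ≐ (λ x → toℕ p * L ≤ toℕ x × toℕ x < toℕ p * L + L)
  block≐interval p = (λ { refl → lower , upper }) , λ {x} (pL≤x , x<pL+L) →
    toℕ-injective (trans (toℕ-block x) (≤-antisym
      (s≤s⁻¹ (m<n*o⇒m/o<n (subst (toℕ x <_) (+-comm (toℕ p * L) L) x<pL+L)))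
      (subst (_≤ toℕ x / L) (m*n/n≡m (toℕ p) L) (/-monoˡ-≤ L pL≤x))))
    where
    lower : ∀ {x} → toℕ (block x) * L ≤ toℕ x
    lower {x} = subst (λ b → b * L ≤ toℕ x) (sym (toℕ-block x)) (m/n*n≤m (toℕ x) L)
    upper : ∀ {x} → toℕ x < toℕ (block x) * L + L
    upper {x} = begin-strict
      toℕ x                        ≡⟨ m≡m%n+[m/n]*n (toℕ x) L ⟩
      toℕ x % L + toℕ x / L * L    <⟨ +-monoˡ-< _ (m%n<n (toℕ x) L) ⟩
      L + toℕ x / L * L            ≡⟨ +-comm L _ ⟩
      toℕ x / L * L + L            ≡⟨ cong (λ b → b * L + L) (toℕ-block x) ⟨
      toℕ (block x) * L + L        ∎
      where open ≤-Reasoning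

  first : Fin (suc q) → Fin order
  first p = fromℕ< (≤-<-trans (*-monoˡ-≤ L (s≤s⁻¹ (toℕ<n p))) (m<m+n (q * L) (s≤s z≤n)))

  blockGraph : CompleteMultipartite
  blockGraph = record { N = order ; k = suc q ; part = block ; onto = λ p → first p , block-first p }
    where
    block-first : ∀ p → block (first p) ≡ p
    block-first p = proj₂ (block≐interval p) (≤-reflexive (sym (toℕ-fromℕ< _)) ,
                      subst (_< toℕ p * L + L) (sym (toℕ-fromℕ< _)) (m<m+n _ (ℕ.>-nonZero⁻¹ L)))

  blockPrefix⊆block : ∀ p → (λ x → toℕ p * L ≤ toℕ x × toℕ x < toℕ p * L + suc ρ) ⊆ (λ x → block x ≡ p)
  blockPrefix⊆block p (pL≤x , x<pL+ρ+1) =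
    proj₂ (block≐interval p) (pL≤x , <-≤-trans x<pL+ρ+1 (+-monoʳ-≤ _ ρ<L))

  blockSize-≥ : ∀ p → suc ρ ≤ classSize block p
  blockSize-≥ p = begin
    suc ρ                               ≡⟨ m+n∸m≡n (toℕ p * L) (suc ρ) ⟨
    toℕ p * L + suc ρ ∸ toℕ p * L       ≡⟨ count-interval prefix? (m≤m+n _ _) pL+ρ+1≤order (id , id) ⟨
    count prefix?                       ≤⟨ count-mono prefix? (λ x → block x Fin.≟ p) (blockPrefix⊆block p) ⟩
    classSize block p                   ∎
    where
    open ≤-Reasoning
    prefix? : Decidable (λ x → toℕ p * L ≤ toℕ x × toℕ x < toℕ p * L + suc ρ)
    prefix? x = (toℕ p * L ≤? toℕ x) ×-dec (toℕ x <? toℕ p * L + suc ρ)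
    pL+ρ+1≤order : toℕ p * L + suc ρ ≤ order
    pL+ρ+1≤order = +-monoˡ-≤ (suc ρ) (*-monoˡ-≤ L (s≤s⁻¹ (toℕ<n p)))

  lastBlock-size : classSize block (fromℕ q) ≡ suc ρ
  lastBlock-size = trans (count-interval (λ x → block x Fin.≟ fromℕ q) (m≤m+n _ _) ≤-refl (in-last , last-in))
                         (m+n∸m≡n (q * L) (suc ρ))
    where
    qL≡ : toℕ (fromℕ q) * L ≡ q * L
    qL≡ = cong (_* L) (FinP.toℕ-fromℕ q)
    in-last : (λ x → block x ≡ fromℕ q) ⊆ (λ x → q * L ≤ toℕ x × toℕ x < order)
    in-last {x} x∈last = subst (_≤ toℕ x) qL≡ (proj₁ (proj₁ (block≐interval _) x∈last)) , toℕ<n x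
    last-in : (λ x → q * L ≤ toℕ x × toℕ x < order) ⊆ (λ x → block x ≡ fromℕ q)
    last-in {x} (qL≤x , x<order) =
      blockPrefix⊆block (fromℕ q)
        (subst (_≤ toℕ x) (sym qL≡) qL≤x , subst (toℕ x <_) (cong (_+ suc ρ) (sym qL≡)) x<order)

  blockGraph-σ : IsSigma (edgesOf blockGraph) (suc q) (suc ρ)
  blockGraph-σ = (block , (λ _ _ different → different) , fromℕ q , lastBlock-size) , colourClass-≥
    where
    colourClass-≥ : ∀ c → ProperColouring (edgesOf blockGraph) (suc q) c → ∀ i → suc ρ ≤ classSize c i
    colourClass-≥ c proper i with colourClass-⊇-part blockGraph proper i
    ... | p , p⊆i = ≤-trans (blockSize-≥ p) (count-mono (λ x → block x Fin.≟ p) (λ x → c x Fin.≟ i) (p⊆i _))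

  blockGraph-χcr : 1 ≤ q → IsChiCr (edgesOf blockGraph) ((q * order) ÷ℕ (q * L))
  blockGraph-χcr q≥1 = suc q , suc ρ , multipartite-chromatic blockGraph , blockGraph-σ , ρ+1<order ,
                       sym (cong (λ d → (q * order) ÷ℕ d) (m+n∸n≡m (q * L) (suc ρ)))
    where
    ρ+1<order : suc ρ < order
    ρ+1<order = subst (suc ρ <_) (+-comm (suc ρ) (q * L)) (m<m+n (suc ρ) (*-mono-≤ q≥1 (ℕ.>-nonZero⁻¹ L)))

  blockGraph-fitsInWindow : ∀ {σ φ} → IsIntervalLabelling blockGraph σ φ → PartsFitInWindow blockGraph φ L
  blockGraph-fitsInWindow {σ} {φ} labelling = partsFitInWindow blockGraph {σ} {φ} labelling residue residue-injective
    where
    residue : Fin order → Fin L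
    residue x = fromℕ< (m%n<n (toℕ x) L)
    residue-injective : ∀ {x y} → block x ≡ block y → residue x ≡ residue y → x ≡ y
    residue-injective {x} {y} same-block same-residue = toℕ-injective (begin
      toℕ x                        ≡⟨ m≡m%n+[m/n]*n (toℕ x) L ⟩
      toℕ x % L + toℕ x / L * L    ≡⟨ cong₂ (λ r d → r + d * L) %-equal /-equal ⟩
      toℕ y % L + toℕ y / L * L    ≡⟨ m≡m%n+[m/n]*n (toℕ y) L ⟨
      toℕ y                        ∎)
      where
      open ≡-Reasoning
      %-equal : toℕ x % L ≡ toℕ y % L
      %-equal = trans (sym (toℕ-fromℕ< _)) (trans (cong toℕ same-residue) (toℕ-fromℕ< _))
      /-equal : toℕ x / L ≡ toℕ y / L
      /-equal = trans (sym (toℕ-block x)) (trans (cong toℕ same-block) (toℕ-block y))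

-- Tiling the blow-up

-- With t = au, the j-th copy puts the vertex at offset k of a class of size a starting at s
-- into block s + ⌊j/u⌋ at slot (j mod u)a + k, i.e. at position ts + aj + k of B(t) ('place'):
-- the t copies of a class fill the ta positions of its blocks in order.
module Tiling {h r} {H : OrderedGraph h} (C : IntervalColouring H r)
              {ℓ : ℕ} (ℓ≤size : ∀ i → ℓ ≤ classSize (col C) i)
              (B : CompleteMultipartite) (h≡N : h ≡ N B)
              {φ : Fin (N B) ↔ Fin (N B)} (fits : PartsFitInWindow B φ ℓ)
              (t : ℕ) .{{_ : NonZero t}} (size∣t : ∀ i → classSize (col C) i ∣ t) where

  open IntervalClasses C
  open +-*-Solver

  cofactor : Fin h → ℕ
  cofactor v = _∣_.quotient (size∣t (col C v))

  size*cofactor≡t : ∀ v → classSizeOf v * cofactor v ≡ t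
  size*cofactor≡t v = trans (*-comm (classSizeOf v) (cofactor v)) (sym (_∣_.equality (size∣t (col C v))))

  instance
    cofactor≢0 : ∀ {v} → NonZero (cofactor v)
    cofactor≢0 {v} = m*n≢0⇒n≢0 (classSizeOf v) {{subst NonZero (sym (size*cofactor≡t v)) it}}

  offset : Fin h → ℕ
  offset v = toℕ v ∸ classStart v

  offset<size : ∀ v → offset v < classSizeOf v
  offset<size v =
    subst (offset v <_) (m+n∸m≡n (classStart v) (classSizeOf v)) (∸-monoˡ-< (<classEnd v) (classStart≤ v))

  j/cofactor<size : ∀ (j : Fin t) v → toℕ j / cofactor v < classSizeOf v
  j/cofactor<size j v = m<n*o⇒m/o<n (subst (toℕ j <_) (sym (size*cofactor≡t v)) (toℕ<n j))

  blockIndex : Fin t → Fin h → ℕ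
  blockIndex j v = classStart v + toℕ j / cofactor v

  blockIndex<N : ∀ j v → blockIndex j v < N B
  blockIndex<N j v = subst (blockIndex j v <_) h≡N
    (<-≤-trans (+-monoʳ-< (classStart v) (j/cofactor<size j v)) (classEnd≤ v))

  slotIndex : Fin t → Fin h → ℕ
  slotIndex j v = toℕ j % cofactor v * classSizeOf v + offset v

  slotIndex<t : ∀ j v → slotIndex j v < t
  slotIndex<t j v = begin-strict
    toℕ j % cofactor v * classSizeOf v + offset v    ≡⟨ cong (_+ offset v) (*-comm (toℕ j % cofactor v) (classSizeOf v)) ⟩
    classSizeOf v * (toℕ j % cofactor v) + offset v  <⟨ m*n+o<m*p (offset<size v) (m%n<n (toℕ j) (cofactor v)) ⟩
    classSizeOf v * cofactor v                       ≡⟨ size*cofactor≡t v ⟩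
    t                                           ∎
    where open ≤-Reasoning

  blockOf : Fin t → Fin h → Fin (N B)
  blockOf j v = fromℕ< (blockIndex<N j v)

  copy : Fin t → Fin h → Fin (N B * t)
  copy j v = Fin.combine (blockOf j v) (fromℕ< (slotIndex<t j v))

  quotient-copy : ∀ j v → Fin.quotient t (copy j v) ≡ blockOf j v
  quotient-copy j v = cong proj₁ (FinP.remQuot-combine (blockOf j v) _)

  place : Fin t → Fin r → ℕ → ℕ
  place j i k = t * boundary (toℕ i) + (size i * toℕ j + k)

  toℕ-copy : ∀ j v → toℕ (copy j v) ≡ place j (col C v) (offset v)
  toℕ-copy j v = begin
    toℕ (copy j v)                                    ≡⟨ FinP.toℕ-combine (blockOf j v) _ ⟩
    t * toℕ (blockOf j v) + toℕ (fromℕ< (slotIndex<t j v)) ≡⟨ cong₂ (λ b x → t * b + x) (toℕ-fromℕ< _) (toℕ-fromℕ< _) ⟩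
    t * (s + D) + (R * a + o)                         ≡⟨ solve 6 (λ t s D R a o → t :* (s :+ D) :+ (R :* a :+ o)
                                                                := t :* s :+ (t :* D :+ R :* a :+ o)) refl t s D R a o ⟩
    t * s + (t * D + R * a + o)                       ≡⟨ cong (λ x → t * s + (x * D + R * a + o)) (size*cofactor≡t v) ⟨
    t * s + (a * u * D + R * a + o)                   ≡⟨ cong (t * s +_) (solve 5 (λ a u D R o → a :* u :* D :+ R :* a :+ o
                                                                := a :* (R :+ D :* u) :+ o) refl a u D R o) ⟩
    t * s + (a * (R + D * u) + o)                     ≡⟨ cong (λ x → t * s + (a * x + o)) (m≡m%n+[m/n]*n (toℕ j) u) ⟨
    t * s + (a * toℕ j + o)                           ∎
    where
    open ≡-Reasoning
    s = classStart v
    a = classSizeOf v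
    u = cofactor v
    o = offset v
    D = toℕ j / u
    R = toℕ j % u

  t*boundary≤place : ∀ j i k → t * boundary (toℕ i) ≤ place j i k
  t*boundary≤place j i k = m≤m+n _ _

  place<t*boundary-suc : ∀ j i {k} → k < size i → place j i k < t * boundary (suc (toℕ i))
  place<t*boundary-suc j i {k} k<size = begin-strict
    t * boundary (toℕ i) + (size i * toℕ j + k)   <⟨ +-monoʳ-< (t * boundary (toℕ i)) (m*n+o<m*p k<size (toℕ<n j)) ⟩
    t * boundary (toℕ i) + size i * t             ≡⟨ cong (t * boundary (toℕ i) +_) (*-comm (size i) t) ⟩
    t * boundary (toℕ i) + t * size i             ≡⟨ *-distribˡ-+ t _ _ ⟨
    t * (boundary (toℕ i) + size i)               ≡⟨ cong (t *_) (boundary-suc i) ⟨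
    t * boundary (suc (toℕ i))                    ∎
    where open ≤-Reasoning

  place-sameClass : ∀ j v w → col C v ≡ col C w →
                    place j (col C v) (offset v) ≡ place j (col C w) (toℕ v ∸ classStart w)
  place-sameClass j v w same = cong (λ i → place j i (toℕ v ∸ boundary (toℕ i))) same

  copy-ordered-by-class : ∀ i j v w → toℕ (col C v) < toℕ (col C w) → toℕ (copy i v) < toℕ (copy j w)
  copy-ordered-by-class i j v w cv<cw = begin-strict
    toℕ (copy i v)                        ≡⟨ toℕ-copy i v ⟩
    place i (col C v) (offset v)          <⟨ place<t*boundary-suc i (col C v) (offset<size v) ⟩
    t * boundary (suc (toℕ (col C v)))    ≤⟨ *-monoʳ-≤ t (boundary-mono cv<cw) ⟩
    t * classStart w                      ≤⟨ t*boundary≤place j (col C w) (offset w) ⟩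
    place j (col C w) (offset w)          ≡⟨ toℕ-copy j w ⟨
    toℕ (copy j w)                        ∎
    where open ≤-Reasoning

  copy-strictMono : ∀ j → StrictMono (copy j)
  copy-strictMono j v w v<w with m≤n⇒m<n∨m≡n (monotone C v w (<⇒≤ v<w))
  ... | inj₁ cv<cw = copy-ordered-by-class j j v w cv<cw
  ... | inj₂ cv≡cw = begin-strict
    toℕ (copy j v)                                  ≡⟨ trans (toℕ-copy j v) (place-sameClass j v w same) ⟩
    place j (col C w) (toℕ v ∸ classStart w)        <⟨ +-monoʳ-< (t * classStart w)
                                                          (+-monoʳ-< (classSizeOf w * toℕ j) (∸-monoˡ-< v<w start≤v)) ⟩
    place j (col C w) (offset w)                    ≡⟨ toℕ-copy j w ⟨
    toℕ (copy j w)                                  ∎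
    where
    open ≤-Reasoning
    same : col C v ≡ col C w
    same = toℕ-injective cv≡cw
    start≤v : classStart w ≤ toℕ v
    start≤v = subst (λ i → boundary (toℕ i) ≤ toℕ v) same (classStart≤ v)

  blockIndex-gap : ∀ j v w → toℕ (col C v) < toℕ (col C w) → blockIndex j v + ℓ ≤ blockIndex j w
  blockIndex-gap j v w cv<cw with classStart-after v w cv<cw
  ... | inj₁ adjacent = begin
    classStart v + toℕ j / cofactor v + ℓ             ≡⟨ +-assoc (classStart v) _ ℓ ⟩
    classStart v + (toℕ j / cofactor v + ℓ)           ≤⟨ +-monoʳ-≤ (classStart v) floor-shift ⟩
    classStart v + (classSizeOf v + toℕ j / cofactor w)    ≡⟨ +-assoc (classStart v) (classSizeOf v) _ ⟨
    classEnd v + toℕ j / cofactor w                   ≡⟨ cong (_+ toℕ j / cofactor w) adjacent ⟨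
    blockIndex j w                                    ∎
    where
    open ≤-Reasoning
    floor-shift : toℕ j / cofactor v + ℓ ≤ classSizeOf v + toℕ j / cofactor w
    floor-shift = floor-shift-≤ (trans (size*cofactor≡t v) (sym (size*cofactor≡t w)))
                    (subst (toℕ j <_) (sym (size*cofactor≡t v)) (toℕ<n j)) (ℓ≤size _) (ℓ≤size _)
  ... | inj₂ (i , end+size≤start) = begin
    classStart v + toℕ j / cofactor v + ℓ    ≤⟨ +-mono-≤ (+-monoʳ-≤ (classStart v) (<⇒≤ (j/cofactor<size j v))) (ℓ≤size i) ⟩
    classEnd v + size i                      ≤⟨ end+size≤start ⟩
    classStart w                             ≤⟨ m≤m+n _ _ ⟩
    blockIndex j w                           ∎
    where open ≤-Reasoning

  blocks-separated : ∀ j v w → toℕ (col C v) < toℕ (col C w) →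
                     partAt B φ (blockOf j v) ≢ partAt B φ (blockOf j w)
  blocks-separated j v w cv<cw same-part = <⇒≱ (fits (≤-trans (m≤m+n _ ℓ) gap) same-part) gap
    where
    gap : toℕ (blockOf j v) + ℓ ≤ toℕ (blockOf j w)
    gap = subst₂ (λ b b' → b + ℓ ≤ b') (sym (toℕ-fromℕ< _)) (sym (toℕ-fromℕ< _)) (blockIndex-gap j v w cv<cw)

  copy-edges : ∀ j v w → E H v w → blowUp B φ t (copy j v) (copy j w)
  copy-edges j v w vw =
    subst₂ (λ b b' → partAt B φ b ≢ partAt B φ b') (sym (quotient-copy j v)) (sym (quotient-copy j w)) separated
    where
    separated : partAt B φ (blockOf j v) ≢ partAt B φ (blockOf j w)
    separated with FinP.<-cmp (col C v) (col C w)
    ... | tri< cv<cw _ _ = blocks-separated j v w cv<cw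
    ... | tri≈ _ cv≡cw _ = ⊥-elim (indep C v w vw cv≡cw)
    ... | tri> _ _ cw<cv = blocks-separated j w v cw<cv ∘ sym

  copies-disjoint : ∀ i j v w → copy i v ≡ copy j w → i ≡ j
  copies-disjoint i j v w same-vertex with FinP.<-cmp (col C v) (col C w)
  ... | tri< cv<cw _ _ = ⊥-elim (<-irrefl (cong toℕ same-vertex) (copy-ordered-by-class i j v w cv<cw))
  ... | tri> _ _ cw<cv = ⊥-elim (<-irrefl (cong toℕ (sym same-vertex)) (copy-ordered-by-class j i w v cw<cv))
  ... | tri≈ _ same _ =
    toℕ-injective (*+-cancel offset-v<size (offset<size w) (+-cancelˡ-≡ (t * classStart w) _ _ same-place))
    where
    same-place : place i (col C w) (toℕ v ∸ classStart w) ≡ place j (col C w) (offset w)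
    same-place = trans (sym (place-sameClass i v w same))
                       (trans (sym (toℕ-copy i v)) (trans (cong toℕ same-vertex) (toℕ-copy j w)))
    offset-v<size : toℕ v ∸ classStart w < classSizeOf w
    offset-v<size = subst (λ c → toℕ v ∸ boundary (toℕ c) < size c) same (offset<size v)

  place-onto : ∀ u {o} → o < t * classSizeOf u → ∃[ j ] ∃[ v ] place j (col C v) (offset v) ≡ t * classStart u + o
  place-onto u {o} o<ta = j , v , (begin
    place j (col C v) (offset v)        ≡⟨ place-sameClass j v u same ⟩
    t * c + (a * toℕ j + (toℕ v ∸ c))   ≡⟨ cong₂ (λ x y → t * c + (a * x + y)) (toℕ-fromℕ< _) v∸c≡o%a ⟩
    t * c + (a * (o / a) + o % a)       ≡⟨ cong (λ x → t * c + (x + o % a)) (*-comm a (o / a)) ⟩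
    t * c + (o / a * a + o % a)         ≡⟨ cong (t * c +_) (trans (+-comm _ (o % a)) (sym (m≡m%n+[m/n]*n o a))) ⟩
    t * c + o                           ∎)
    where
    open ≡-Reasoning
    c = classStart u
    a = classSizeOf u
    instance
      a≢0 : NonZero a
      a≢0 = ℕ.>-nonZero (m<n⇒0<n (offset<size u))
    j : Fin t
    j = fromℕ< (m<n*o⇒m/o<n o<ta)
    v<h : c + o % a < h
    v<h = <-≤-trans (+-monoʳ-< c (m%n<n o a)) (classEnd≤ u)
    v : Fin h
    v = fromℕ< v<h
    v∸c≡o%a : toℕ v ∸ c ≡ o % a
    v∸c≡o%a = trans (cong (_∸ c) (toℕ-fromℕ< v<h)) (m+n∸m≡n c (o % a))
    same : col C v ≡ col C u
    same = sameClass u v (subst (c ≤_) (sym (toℕ-fromℕ< v<h)) (m≤m+n c (o % a)))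
                         (subst (_< classEnd u) (sym (toℕ-fromℕ< v<h)) (+-monoʳ-< c (m%n<n o a)))

  copies-cover : ∀ p → Σ (Fin t) λ j → Σ (Fin h) λ v → copy j v ≡ p
  copies-cover p = j , v , toℕ-injective (begin
    toℕ (copy j v)                            ≡⟨ toℕ-copy j v ⟩
    place j (col C v) (offset v)              ≡⟨ place≡ ⟩
    t * classStart u + (t * offset u + toℕ s) ≡⟨ +-assoc (t * classStart u) _ _ ⟨
    t * classStart u + t * offset u + toℕ s   ≡⟨ cong (_+ toℕ s) (*-distribˡ-+ t (classStart u) (offset u)) ⟨
    t * (classStart u + offset u) + toℕ s     ≡⟨ cong (λ x → t * x + toℕ s) (m+[n∸m]≡n (classStart≤ u)) ⟩
    t * toℕ u + toℕ s                         ≡⟨ cong (λ x → t * x + toℕ s) (toℕ-fromℕ< _) ⟩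
    t * toℕ b + toℕ s                         ≡⟨ FinP.toℕ-combine b s ⟨
    toℕ (Fin.combine b s)                     ≡⟨ cong toℕ (FinP.combine-remQuot {N B} t p) ⟩
    toℕ p                                     ∎)
    where
    open ≡-Reasoning
    b = proj₁ (Fin.remQuot {N B} t p)
    s = proj₂ (Fin.remQuot {N B} t p)
    u : Fin h
    u = fromℕ< (subst (toℕ b <_) (sym h≡N) (toℕ<n b))
    o<ta : t * offset u + toℕ s < t * classSizeOf u
    o<ta = m*n+o<m*p (toℕ<n s) (offset<size u)
    hit = place-onto u o<ta
    j = proj₁ hit
    v = proj₁ (proj₂ hit)
    place≡ = proj₂ (proj₂ hit)

  tiling : PerfectTiling H (blowUp B φ t)
  tiling = record
    { m        = t
    ; copy     = copy
    ; isCopy   = λ j → copy-strictMono j , copy-edges j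
    ; disjoint = copies-disjoint
    ; covers   = copies-cover
    }

-- The critical chromatic number

÷ℕ-mono-≤ : ∀ {a b c d} → 1 ≤ b → 1 ≤ d → a * d ≤ c * b → a ÷ℕ b ℚ.≤ c ÷ℕ d
÷ℕ-mono-≤ {a} {suc b} {c} {suc d} _ _ ad≤cb = ℚP.toℚᵘ-cancel-≤
  (ℚᵘP.≤-respʳ-≃ (ℚᵘP.≃-sym (ℚP.toℚᵘ-fromℚᵘ (mkℚᵘ (ℤ.+ c) d)))
    (ℚᵘP.≤-respˡ-≃ (ℚᵘP.≃-sym (ℚP.toℚᵘ-fromℚᵘ (mkℚᵘ (ℤ.+ a) b)))
      (ℚᵘ.*≤* (subst₂ ℤ._≤_ (ℤP.pos-* a (suc d)) (ℤP.pos-* c (suc b)) (ℤ.+≤+ ad≤cb)))))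

-- An unnormalised sum keeps the product denominator, so this is the cross-multiplied
-- inequality (d + 2)(d + 1) ≤ ((d + 1) + (n + 1))(d + 1) with unit factors left in.
[2+d]/[1+d]≤1+[1+n]/[1+d] : ∀ n d → mkℚᵘ (ℤ.+ suc (suc d)) d ℚᵘ.≤ mkℚᵘ (ℤ.+ 1) 0 ℚᵘ.+ mkℚᵘ ℤ.+[1+ n ] d
[2+d]/[1+d]≤1+[1+n]/[1+d] n d =
  ℚᵘ.*≤* (ℤ.+≤+ (subst (lhs ≤_) (sym (rearrange n d)) (m≤m+n lhs (n * suc d))))
  where
  lhs = suc (d + 0 * suc d + suc d * suc (d + 0 * suc d))
  rearrange : ∀ n d → suc (d + (d + 0 * suc d + suc (n * 1)) * suc d)
                    ≡ suc (d + 0 * suc d + suc d * suc (d + 0 * suc d)) + n * suc d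
  rearrange = solve-∀

[2+d]/[1+d]-close-to-1 : ∀ ε → 0ℚ ℚ.< ε → ∃[ d ] suc (suc d) ÷ℕ suc d ℚ.≤ 1 ÷ℕ 1 ℚ.+ ε
[2+d]/[1+d]-close-to-1 ε@(mkℚ ℤ.+[1+ n ] d _) _ = d , ℚP.toℚᵘ-cancel-≤
  (ℚᵘP.≤-respʳ-≃ (ℚᵘP.≃-sym (ℚP.toℚᵘ-homo-+ (1 ÷ℕ 1) ε))
    (ℚᵘP.≤-respˡ-≃ (ℚᵘP.≃-sym (ℚP.toℚᵘ-fromℚᵘ (mkℚᵘ (ℤ.+ suc (suc d)) d)))
      ([2+d]/[1+d]≤1+[1+n]/[1+d] n d)))
[2+d]/[1+d]-close-to-1 (mkℚ (ℤ.+ zero)   _ _) (ℚ.*<* (ℤ.+<+ ()))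
[2+d]/[1+d]-close-to-1 (mkℚ ℤ.-[1+ _ ]   _ _) (ℚ.*<* ())

ChiStarCrLe-mono : ∀ {h} {H : OrderedGraph h} {x y} → x ℚ.≤ y → ChiStarCrLe H x → ChiStarCrLe H y
ChiStarCrLe-mono x≤y χ*≤x ε ε>0 with χ*≤x ε ε>0
... | B , bottlegraph , q , χcr≡q , q≤x+ε =
  B , bottlegraph , q , χcr≡q , ℚP.≤-trans q≤x+ε (ℚP.+-monoˡ-≤ ε x≤y)

bottlegraph⇒ChiStarCrLe : ∀ {h} {H : OrderedGraph h} {B q} → IsBottlegraph H B → IsChiCr (edgesOf B) q →
                          ChiStarCrLe H q
bottlegraph⇒ChiStarCrLe {B = B} {q} bottlegraph χcr≡q ε ε>0 =
  B , bottlegraph , q , χcr≡q ,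
  ℚP.≤-trans (ℚP.≤-reflexive (sym (ℚP.+-identityʳ q))) (ℚP.+-monoʳ-≤ q (ℚP.<⇒≤ ε>0))

edgeless-tiling : ∀ {h m} {H : OrderedGraph h} → (∀ a b → ¬ E H a b) →
                  (G : Fin (m * h) → Fin (m * h) → Set) → PerfectTiling H G
edgeless-tiling {h} {m} no-edges G = record
  { m        = m
  ; copy     = Fin.combine
  ; isCopy   = λ i → combine-strictMono i , λ a b ab → ⊥-elim (no-edges a b ab)
  ; disjoint = λ i j a b → FinP.combine-injectiveˡ i a j b
  ; covers   = λ p → proj₁ (Fin.remQuot {m} h p) , proj₂ (Fin.remQuot {m} h p) , FinP.combine-remQuot {m} h p
  }
  where
  combine-strictMono : ∀ i → StrictMono (Fin.combine {m} {h} i)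
  combine-strictMono i a b a<b =
    subst₂ _<_ (sym (FinP.toℕ-combine i a)) (sym (FinP.toℕ-combine i b)) (+-monoʳ-< (h * toℕ i) a<b)

-- No bottlegraph attains χ_cr = 1, but (d + 2)/(d + 1) is attained by the complete
-- bipartite graph with parts of sizes d + 1 and 1.
edgeless-ChiStarCrLe : ∀ {h} {H : OrderedGraph h} → 1 ≤ h → (∀ a b → ¬ E H a b) → ChiStarCrLe H (1 ÷ℕ 1)
edgeless-ChiStarCrLe {h} {H} h≥1 no-edges ε ε>0 with [2+d]/[1+d]-close-to-1 ε ε>0
... | d , close = blockGraph , bottlegraph , _ , blockGraph-χcr ≤-refl , ℚP.≤-trans χcr≤ close
  where
  open BlockGraph (suc d) 1 0 (s≤s z≤n)
  bottlegraph : IsBottlegraph H blockGraph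
  bottlegraph σ φ _ = h , h≥1 , edgeless-tiling {m = order} no-edges _
  χcr≤ : (1 * order) ÷ℕ (1 * suc d) ℚ.≤ suc (suc d) ÷ℕ suc d
  χcr≤ = ÷ℕ-mono-≤ {1 * order} {1 * suc d} {suc (suc d)} {suc d} (s≤s z≤n) (s≤s z≤n) (≤-reflexive (cross d))
    where
    cross : ∀ d → 1 * (1 * suc d + 1) * suc d ≡ suc (suc d) * (1 * suc d)
    cross = solve-∀

n∣n! : ∀ {n} → 1 ≤ n → n ∣ n !
n∣n! {suc n} _ = m∣m*n (n !)

intervalColouring-ChiStarCrLe : ∀ {h r ℓ} {H : OrderedGraph h} (C : IntervalColouring H r) →
                                (∀ i → ℓ ≤ classSize (col C) i) → 1 ≤ ℓ → ℓ < h → ChiStarCrLe H (h ÷ℕ ℓ)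
intervalColouring-ChiStarCrLe {suc h'} {ℓ = ℓ} {H} C ℓ≤size ℓ≥1 ℓ<h =
  ChiStarCrLe-mono χcr≤h/ℓ (bottlegraph⇒ChiStarCrLe {B = blockGraph} bottlegraph (blockGraph-χcr q≥1))
  where
  h = suc h'
  instance
    ℓ≢0 : NonZero ℓ
    ℓ≢0 = ℕ.>-nonZero ℓ≥1
    h!≢0 : NonZero (h !)
    h!≢0 = h !≢0
  q = h' / ℓ
  open BlockGraph ℓ q (h' % ℓ) (m%n<n h' ℓ)
  h≡order : h ≡ order
  h≡order = trans (cong suc (trans (m≡m%n+[m/n]*n h' ℓ) (+-comm (h' % ℓ) (q * ℓ))))
                  (sym (+-suc (q * ℓ) (h' % ℓ)))
  q≥1 : 1 ≤ q
  q≥1 = subst (_≤ q) (n/n≡1 ℓ) (/-monoˡ-≤ ℓ (s≤s⁻¹ ℓ<h))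
  size∣h! : ∀ i → classSize (col C) i ∣ h !
  size∣h! i = ∣-trans (n∣n! (≤-trans ℓ≥1 (ℓ≤size i))) (m≤n⇒m!∣n! (count-≤ (λ x → col C x Fin.≟ i)))
  bottlegraph : IsBottlegraph H blockGraph
  bottlegraph σ φ labelling =
    h ! , ℕ.>-nonZero⁻¹ (h !) ,
    Tiling.tiling C ℓ≤size blockGraph h≡order {φ} (blockGraph-fitsInWindow {σ} {φ} labelling) (h !) size∣h!
  χcr≤h/ℓ : (q * order) ÷ℕ (q * ℓ) ℚ.≤ h ÷ℕ ℓ
  χcr≤h/ℓ = ÷ℕ-mono-≤ (*-mono-≤ q≥1 ℓ≥1) ℓ≥1 (≤-reflexive (begin
    q * order * ℓ    ≡⟨ solve 3 (λ q n l → q :* n :* l := n :* (q :* l)) refl q order ℓ ⟩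
    order * (q * ℓ)  ≡⟨ cong (_* (q * ℓ)) h≡order ⟨
    h * (q * ℓ)      ∎))
    where
    open ≡-Reasoning
    open +-*-Solver

module _ {n r} {c : Fin n → Fin r} {ℓ} (minimal : IsMinClassSize c ℓ) where

  minClassSize-≥1 : (∀ i → Σ (Fin n) λ x → c x ≡ i) → 1 ≤ ℓ
  minClassSize-≥1 onto with proj₂ minimal
  ... | i , size≡ℓ = subst (1 ≤_) size≡ℓ (count-pos (λ x → c x Fin.≟ i) _ (proj₂ (onto i)))

  minClassSize-≤ : ℓ ≤ n
  minClassSize-≤ with proj₂ minimal
  ... | i , size≡ℓ = subst (_≤ n) size≡ℓ (count-≤ (λ x → c x Fin.≟ i))

  minClassSize-< : 2 ≤ r → 1 ≤ ℓ → ℓ < n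
  minClassSize-< (s≤s (s≤s _)) ℓ≥1 = begin-strict
    ℓ                                                      <⟨ m<m+n ℓ ℓ≥1 ⟩
    ℓ + ℓ                                                  ≤⟨ +-mono-≤ (proj₁ minimal _) (proj₁ minimal _) ⟩
    classSize c Fin.zero + classSize c (Fin.suc Fin.zero)  ≤⟨ classSize-+-≤ c (λ ()) ⟩
    n                                                      ∎
    where open ≤-Reasoning

proposition11p2 : ∀ (h : ℕ) (H : OrderedGraph h) → 1 ≤ h →
    ∀ (r ℓ : ℕ) → IsIntervalChromatic H r → IsLPlus H r ℓ →
    ChiStarCrLe H (h ÷ℕ ℓ)
proposition11p2 h H h≥1 zero ℓ _ ((C , _) , _) = ⊥-elim (FinP.¬Fin0 (col C (fromℕ< h≥1)))
proposition11p2 h H h≥1 (suc zero) ℓ _ ((C , minimal) , _) =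
  ChiStarCrLe-mono 1≤h/ℓ (edgeless-ChiStarCrLe h≥1 (λ a b ab → indep C a b ab (single (col C a) (col C b))))
  where
  single : (i j : Fin 1) → i ≡ j
  single Fin.zero Fin.zero = refl
  1≤h/ℓ : 1 ÷ℕ 1 ℚ.≤ h ÷ℕ ℓ
  1≤h/ℓ = ÷ℕ-mono-≤ {1} {1} {h} {ℓ} ≤-refl (minClassSize-≥1 minimal (onto C))
            (subst₂ _≤_ (sym (*-identityˡ ℓ)) (sym (*-identityʳ h)) (minClassSize-≤ minimal))
proposition11p2 h H h≥1 (suc (suc _)) ℓ _ ((C , minimal) , _) =
  intervalColouring-ChiStarCrLe C (proj₁ minimal) ℓ≥1 (minClassSize-< minimal (s≤s (s≤s z≤n)) ℓ≥1)
  where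
  ℓ≥1 = minClassSize-≥1 minimal (onto C)
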